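{- Let $S$ be a reflective numerical semigroup with genus $g(S)=g\ge1$ and multiplicity $m(S)=a$. Then \[ e(S)\ge \frac{F(S)+1}{F(S)+1-g(S)}. \]
   Context: A numerical semigroup is a submonoid $S$ of $(\mathbb{N}_0,+)$ with finite complement; $g(S)=\#(\mathbb{N}_0\setminus S)$, $m(S)$ is its smallest positive element, $F(S)$ is the largest element of $\mathbb{N}_0\setminus S$, and $e(S)$ is the cardinality of the minimal generating set of $S$. $S$ (with $g=g(S)\ge1$) is reflective if for every integer $z$ with $0\le z\le g-1$ exactly one of $z$ and $z+g$ lies in $S$. -}

module Defs where

open import Data.Nat using (ℕ; zero; suc; _+_; _*_; _∸_; _≤_; _<_)
open import Data.Bool using (Bool; true; false; not; _∧_; _∨_)
open import Data.Product using (_×_; ∃)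
open import Data.Sum using (_⊎_)
open import Relation.Binary.PropositionalEquality using (_≡_; _≢_)

record NumericalSemigroup : Set where
  field
    mem      : ℕ → Bool
    zero∈    : mem 0 ≡ true
    closed   : ∀ x y → mem x ≡ true → mem y ≡ true → mem (x + y) ≡ true
    cofinite : ∃ λ N → ∀ n → N ≤ n → mem n ≡ true

open NumericalSemigroup public

_∈S_ : ℕ → NumericalSemigroup → Set
n ∈S S = mem S n ≡ true

_∉S_ : ℕ → NumericalSemigroup → Set
n ∉S S = mem S n ≡ false

count : (ℕ → Bool) → ℕ → ℕ
count p zero    = 0
count p (suc n) with p n
... | true  = suc (count p n)
... | false = count p n

IsFrobenius : NumericalSemigroup → ℕ → Set
IsFrobenius S F = F ∉S S × (∀ n → F < n → n ∈S S)

-- g(S): number of gaps (all gaps lie in [0, F]).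
genus : NumericalSemigroup → ℕ → ℕ
genus S F = count (λ n → not (mem S n)) (suc F)

IsMultiplicity : NumericalSemigroup → ℕ → Set
IsMultiplicity S a = 0 < a × a ∈S S × (∀ k → 0 < k → k < a → k ∉S S)

decomposable : NumericalSemigroup → ℕ → Bool
decomposable S n = go n
  where
  go : ℕ → Bool
  go zero          = false
  go (suc zero)    = false
  go (suc (suc x)) = (mem S (suc x) ∧ mem S (n ∸ suc x)) ∨ go (suc x)

isMinGen : NumericalSemigroup → ℕ → Bool
isMinGen S zero    = false
isMinGen S (suc n) = mem S (suc n) ∧ not (decomposable S (suc n))

-- e(S): number of minimal generators. Every minimal generator is ≤ F + a
-- (if n > F + a then n - a ∈ S*, so n = a + (n - a) is decomposable),
-- so counting below F + a + 1 counts all of them.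
embeddingDimension : NumericalSemigroup → (F a : ℕ) → ℕ
embeddingDimension S F a = count (isMinGen S) (suc (F + a))

IsReflective : NumericalSemigroup → ℕ → Set
IsReflective S g = ∀ z → z < g →
  (z ∈S S × (z + g) ∉S S) ⊎ (z ∉S S × (z + g) ∈S S)

{-# OPTIONS --safe #-}

-- For z < g, z ↦ z + g exchanges elements and gaps of S, so [0, 2g) already holds g gaps and
-- F < 2g. Put M = F − g < g. Then M ∈ S, (M, g) consists of gaps, and S ∩ [0, M] is stable
-- under z ↦ M − z; with z ↦ z + a this gives z ↦ z − a, so S ∩ [0, g) is the set of multiples
-- of a up to M. If a > g this forces M = 0, F < a, and all of [a, 2a) are minimal generators.
-- If a < g, every element of (g, g + a) lies in S and, apart from the multiple M + a, is a
-- minimal generator; with a itself that makes a − 1 of them, and F + a is one more when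
-- M + a ≤ g + 1. For c such generators F + 1 ≤ 2M + c ≤ c(M + 1) = c(F + 1 − g).
module Submission where

open import Data.Bool using (Bool; true; false; not; _∧_; _∨_)
open import Data.Bool.Properties using (¬-not)
open import Data.Empty using (⊥; ⊥-elim)
open import Data.Nat
open import Data.Nat.Divisibility using (_∣_; divides; _∣0; 1∣_; n∣n; ∣m∸n∣n⇒∣m; ∣m∣n⇒∣m+n; ∣m+n∣m⇒∣n)
open import Data.Nat.Induction using (<-rec)
open import Data.Nat.Properties
open import Data.Product using (_,_; proj₁; proj₂)
open import Data.Sum using (_⊎_; inj₁; inj₂)
open import Relation.Binary using (Tri; tri<; tri≈; tri>)
open import Relation.Binary.PropositionalEquality
open import Relation.Nullary using (¬_; yes; no)

open import Defs

count-suc-true : ∀ p n → p n ≡ true → count p (suc n) ≡ suc (count p n)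
count-suc-true p n pn rewrite pn = refl

count-≤-suc : ∀ p n → count p n ≤ count p (suc n)
count-≤-suc p n with p n
... | true  = n≤1+n (count p n)
... | false = ≤-refl

count-mono : ∀ p {m n} → m ≤ n → count p m ≤ count p n
count-mono p {n = zero} z≤n = ≤-refl
count-mono p {m} {suc n} m≤1+n with m ≟ suc n
... | yes refl   = ≤-refl
... | no m≢1+n   = ≤-trans (count-mono p (s≤s⁻¹ (≤∧≢⇒< m≤1+n m≢1+n))) (count-≤-suc p n)

count-+ : ∀ p m n → count p (m + n) ≡ count p m + count (λ i → p (m + i)) n
count-+ p m zero = trans (cong (count p) (+-identityʳ m)) (sym (+-identityʳ (count p m)))
count-+ p m (suc n) rewrite +-suc m n with p (m + n)
... | true  = trans (cong suc (count-+ p m n)) (sym (+-suc (count p m) _))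
... | false = count-+ p m n

count-all : ∀ p n → (∀ i → i < n → p i ≡ true) → count p n ≡ n
count-all p zero    _   = refl
count-all p (suc n) all = trans (count-suc-true p n (all n ≤-refl))
  (cong suc (count-all p n λ i i<n → all i (m≤n⇒m≤1+n i<n)))

count-all-but-one : ∀ p n j → (∀ i → i < n → i ≢ j → p i ≡ true) → n ≤ suc (count p n)
count-all-but-one p zero    j _   = z≤n
count-all-but-one p (suc n) j all with n ≟ j
... | yes refl = s≤s (≤-trans
  (≤-reflexive (sym (count-all p n λ i i<n → all i (m≤n⇒m≤1+n i<n) (<⇒≢ i<n))))
  (count-≤-suc p n))
... | no n≢j = begin
  suc n                     ≤⟨ s≤s (count-all-but-one p n j λ i i<n → all i (m≤n⇒m≤1+n i<n)) ⟩
  suc (suc (count p n))     ≡⟨ cong suc (count-suc-true p n (all n ≤-refl n≢j)) ⟨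
  suc (count p (suc n))     ∎
  where open ≤-Reasoning

count-∨ : ∀ p q n → (∀ i → i < n → p i ≡ true ⊎ q i ≡ true) → n ≤ count p n + count q n
count-∨ p q zero    _      = z≤n
count-∨ p q (suc n) either
  with either n ≤-refl | count-∨ p q n (λ i i<n → either i (m≤n⇒m≤1+n i<n))
... | inj₁ pn | ih = begin
  suc n                             ≤⟨ s≤s ih ⟩
  suc (count p n) + count q n       ≤⟨ +-mono-≤ (≤-reflexive (sym (count-suc-true p n pn))) (count-≤-suc q n) ⟩
  count p (suc n) + count q (suc n) ∎
  where open ≤-Reasoning
... | inj₂ qn | ih = begin
  suc n                             ≤⟨ s≤s ih ⟩
  suc (count p n + count q n)       ≡⟨ +-suc (count p n) (count q n) ⟨
  count p n + suc (count q n)       ≤⟨ +-mono-≤ (count-≤-suc p n) (≤-reflexive (sym (count-suc-true q n qn))) ⟩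
  count p (suc n) + count q (suc n) ∎
  where open ≤-Reasoning

∣-between : ∀ {a m s} → a ∣ m → a ∣ s → m < s → s < m + a + a → s ≡ m + a
∣-between {a} (divides i refl) (divides j refl) i*a<j*a j*a<i*a+a+a = begin
  j * a     ≡⟨ cong (_* a) (≤-antisym (s≤s⁻¹ j<2+i) (*-cancelʳ-< a i j i*a<j*a)) ⟩
  a + i * a ≡⟨ +-comm a (i * a) ⟩
  i * a + a ∎
  where
  open ≡-Reasoning
  i*a+a+a≡[2+i]*a : i * a + a + a ≡ 2+ i * a
  i*a+a+a≡[2+i]*a = trans (+-comm (i * a + a) a) (cong (a +_) (+-comm (i * a) a))
  j<2+i : j < 2+ i
  j<2+i = *-cancelʳ-< a j (2+ i) (subst (j * a <_) i*a+a+a≡[2+i]*a j*a<i*a+a+a)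

m+m+c≤c*[1+m] : ∀ {m c} → 2 ≤ c → m + m + c ≤ c * suc m
m+m+c≤c*[1+m] {m} {c} 2≤c = begin
  m + m + c   ≡⟨ cong (λ n → m + n + c) (+-identityʳ m) ⟨
  2 * m + c   ≤⟨ +-monoˡ-≤ c (*-monoˡ-≤ m 2≤c) ⟩
  c * m + c   ≡⟨ +-comm (c * m) c ⟩
  c + c * m   ≡⟨ *-suc c m ⟨
  c * suc m   ∎
  where open ≤-Reasoning

∧-false : ∀ {b c} → (b ≡ true → c ≡ true → ⊥) → b ∧ c ≡ false
∧-false {false}         _ = refl
∧-false {true} {false}  _ = refl
∧-false {true} {true}   h = ⊥-elim (h refl refl)

∨-false : ∀ {b c} → b ≡ false → c ≡ false → b ∨ c ≡ false
∨-false refl refl = refl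

module Membership (S : NumericalSemigroup) where

  ∉S⇒¬∈S : ∀ {n} → n ∉S S → ¬ n ∈S S
  ∉S⇒¬∈S n∉S n∈S with () ← trans (sym n∈S) n∉S

  ¬∈S⇒∉S : ∀ {n} → ¬ n ∈S S → n ∉S S
  ¬∈S⇒∉S = ¬-not

IsIndecomposable : NumericalSemigroup → ℕ → Set
IsIndecomposable S s = ∀ x y → 0 < x → 0 < y → x + y ≡ s → x ∈S S → y ∈S S → ⊥

mutual
  -- `decomposable S n` runs a `where`-bound search that cannot be named outside Defs;
  -- `search` is that function, found by unification once the `with`s of `decomposable-2+`
  -- expose its call at two distinct variables.
  search : NumericalSemigroup → ℕ → ℕ → Bool
  search = _

  decomposable-2+ : ∀ S x →
    decomposable S (2+ x) ≡ ((mem S (suc x) ∧ mem S (2+ x ∸ suc x)) ∨ search S (2+ x) (suc x))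
  decomposable-2+ S x with 2+ x
  ... | n with suc x
  ...   | k = refl

search-false : ∀ S n → IsIndecomposable S n → ∀ k → k ≤ n → search S n k ≡ false
search-false S n indec zero       _     = refl
search-false S n indec (suc zero) _     = refl
search-false S n indec (2+ x)     1+x<n =
  ∨-false (∧-false λ 1+x∈S rest∈S →
             indec (suc x) (n ∸ suc x) z<s (m<n⇒0<n∸m 1+x<n) (m+[n∸m]≡n (<⇒≤ 1+x<n)) 1+x∈S rest∈S)
          (search-false S n indec (suc x) (<⇒≤ 1+x<n))

decomposable-false : ∀ S n → IsIndecomposable S n → decomposable S n ≡ false
decomposable-false S zero       _     = refl
decomposable-false S (suc zero) _     = refl
decomposable-false S (2+ x)     indec =
  trans (decomposable-2+ S x) (search-false S (2+ x) indec (2+ x) ≤-refl)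

isMinGen-true : ∀ S s → 0 < s → s ∈S S → IsIndecomposable S s → isMinGen S s ≡ true
isMinGen-true S (suc n) _ s∈S indec rewrite s∈S | decomposable-false S (suc n) indec = refl

module Multiplicity (S : NumericalSemigroup) (a : ℕ) (isM : IsMultiplicity S a) where

  open Membership S

  0<a : 0 < a
  0<a = proj₁ isM

  a∈S : a ∈S S
  a∈S = proj₁ (proj₂ isM)

  0<∧<a⇒∉S : ∀ {k} → 0 < k → k < a → k ∉S S
  0<∧<a⇒∉S = proj₂ (proj₂ isM) _

  a≤∈S : ∀ {x} → 0 < x → x ∈S S → a ≤ x
  a≤∈S 0<x x∈S = ≮⇒≥ λ x<a → ∉S⇒¬∈S (0<∧<a⇒∉S 0<x x<a) x∈S

  *a∈S : ∀ i → (i * a) ∈S S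
  *a∈S zero    = zero∈ S
  *a∈S (suc i) = closed S a (i * a) a∈S (*a∈S i)

  a∣⇒∈S : ∀ {n} → a ∣ n → n ∈S S
  a∣⇒∈S (divides i refl) = *a∈S i

  <a+a⇒isMinGen : ∀ {s} → 0 < s → s ∈S S → s < a + a → isMinGen S s ≡ true
  <a+a⇒isMinGen {s} 0<s s∈S s<a+a = isMinGen-true S s 0<s s∈S λ x y 0<x 0<y x+y≡s x∈S y∈S →
    <⇒≱ s<a+a (subst (a + a ≤_) x+y≡s (+-mono-≤ (a≤∈S 0<x x∈S) (a≤∈S 0<y y∈S)))

  F<a⇒a≤count-isMinGen : ∀ {F} → IsFrobenius S F → F < a → a ≤ count (isMinGen S) (a + a)
  F<a⇒a≤count-isMinGen {F} (_ , >F⇒∈S) F<a = begin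
    a                                            ≡⟨ count-all _ a a+i-isMinGen ⟨
    count (λ i → isMinGen S (a + i)) a          ≤⟨ m≤n+m _ (count (isMinGen S) a) ⟩
    count (isMinGen S) a + count (λ i → isMinGen S (a + i)) a ≡⟨ count-+ (isMinGen S) a a ⟨
    count (isMinGen S) (a + a)                   ∎
    where
    open ≤-Reasoning
    a+i-isMinGen : ∀ i → i < a → isMinGen S (a + i) ≡ true
    a+i-isMinGen i i<a = <a+a⇒isMinGen (<-≤-trans 0<a (m≤m+n a i))
      (>F⇒∈S (a + i) (<-≤-trans F<a (m≤m+n a i))) (+-monoʳ-< a i<a)

module Reflective (S : NumericalSemigroup) (F g a : ℕ) (isF : IsFrobenius S F)
  (genus≡g : genus S F ≡ g) (1≤g : 1 ≤ g) (isM : IsMultiplicity S a) (reflective : IsReflective S g)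
  where

  open Membership S public
  open Multiplicity S a isM public

  F∉S : F ∉S S
  F∉S = proj₁ isF

  >F⇒∈S : ∀ {n} → F < n → n ∈S S
  >F⇒∈S = proj₂ isF _

  ∈S⇒+g∉S : ∀ {z} → z < g → z ∈S S → (z + g) ∉S S
  ∈S⇒+g∉S {z} z<g z∈S with reflective z z<g
  ... | inj₁ (_ , z+g∉S) = z+g∉S
  ... | inj₂ (z∉S , _)   = ⊥-elim (∉S⇒¬∈S z∉S z∈S)

  ∉S⇒+g∈S : ∀ {z} → z < g → z ∉S S → (z + g) ∈S S
  ∉S⇒+g∈S {z} z<g z∉S with reflective z z<g
  ... | inj₁ (z∈S , _)   = ⊥-elim (∉S⇒¬∈S z∉S z∈S)
  ... | inj₂ (_ , z+g∈S) = z+g∈S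

  +g∉S⇒∈S : ∀ {z} → z < g → (z + g) ∉S S → z ∈S S
  +g∉S⇒∈S {z} z<g z+g∉S with reflective z z<g
  ... | inj₁ (z∈S , _)   = z∈S
  ... | inj₂ (_ , z+g∈S) = ⊥-elim (∉S⇒¬∈S z+g∉S z+g∈S)

  g∉S : g ∉S S
  g∉S = ∈S⇒+g∉S 1≤g (zero∈ S)

  g≤F : g ≤ F
  g≤F = ≮⇒≥ λ F<g → ∉S⇒¬∈S g∉S (>F⇒∈S F<g)

  gap : ℕ → Bool
  gap n = not (mem S n)

  g≤count-gap-[g+g] : g ≤ count gap (g + g)
  g≤count-gap-[g+g] = begin
    g                                       ≤⟨ count-∨ gap (λ i → gap (g + i)) g gap-or-gap ⟩
    count gap g + count (λ i → gap (g + i)) g ≡⟨ count-+ gap g g ⟨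
    count gap (g + g)                       ∎
    where
    open ≤-Reasoning
    gap-or-gap : ∀ z → z < g → gap z ≡ true ⊎ gap (g + z) ≡ true
    gap-or-gap z z<g with reflective z z<g
    ... | inj₁ (_ , z+g∉S) = inj₂ (subst (λ n → gap n ≡ true) (+-comm z g) (cong not z+g∉S))
    ... | inj₂ (z∉S , _)   = inj₁ (cong not z∉S)

  F<g+g : F < g + g
  F<g+g = ≰⇒> λ g+g≤F → <-irrefl (sym genus≡g) (begin-strict
    g                  ≤⟨ g≤count-gap-[g+g] ⟩
    count gap (g + g)  ≤⟨ count-mono gap g+g≤F ⟩
    count gap F        <⟨ ≤-reflexive (sym (count-suc-true gap F (cong not F∉S))) ⟩
    genus S F          ∎)
    where open ≤-Reasoning

  M : ℕ
  M = F ∸ g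

  M+g≡F : M + g ≡ F
  M+g≡F = m∸n+n≡m g≤F

  M<g : M < g
  M<g = subst (M <_) (m+n∸n≡m g g) (∸-monoˡ-< F<g+g g≤F)

  M∈S : M ∈S S
  M∈S = +g∉S⇒∈S M<g (subst (_∉S S) (sym M+g≡F) F∉S)

  ∈S∧<g⇒≤M : ∀ {z} → z < g → z ∈S S → z ≤ M
  ∈S∧<g⇒≤M {z} z<g z∈S = ≮⇒≥ λ M<z →
    ∉S⇒¬∈S (∈S⇒+g∉S z<g z∈S) (>F⇒∈S (subst (_< z + g) M+g≡F (+-monoˡ-< g M<z)))

  ∈S∧≤M⇒M∸∈S : ∀ {z} → z ≤ M → z ∈S S → (M ∸ z) ∈S S
  ∈S∧≤M⇒M∸∈S {z} z≤M z∈S = +g∉S⇒∈S (≤-<-trans (m∸n≤m M z) M<g) (¬∈S⇒∉S λ M∸z+g∈S →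
    ∉S⇒¬∈S F∉S (subst (_∈S S) z+[M∸z+g]≡F (closed S z _ z∈S M∸z+g∈S)))
    where
    open ≡-Reasoning
    z+[M∸z+g]≡F : z + (M ∸ z + g) ≡ F
    z+[M∸z+g]≡F = begin
      z + (M ∸ z + g) ≡⟨ +-assoc z (M ∸ z) g ⟨
      z + (M ∸ z) + g ≡⟨ cong (_+ g) (m+[n∸m]≡n z≤M) ⟩
      M + g           ≡⟨ M+g≡F ⟩
      F               ∎

  ∈S∧≤M⇒∸a∈S : ∀ {z} → z ≤ M → z ∈S S → a ≤ z → (z ∸ a) ∈S S
  ∈S∧≤M⇒∸a∈S {z} z≤M z∈S a≤z = subst (_∈S S) M∸y≡z∸a (∈S∧≤M⇒M∸∈S y≤M y∈S)
    where
    y : ℕ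
    y = M ∸ z + a
    y∈S : y ∈S S
    y∈S = closed S _ a (∈S∧≤M⇒M∸∈S z≤M z∈S) a∈S
    y≤M : y ≤ M
    y≤M = begin
      M ∸ z + a ≤⟨ +-monoʳ-≤ (M ∸ z) a≤z ⟩
      M ∸ z + z ≡⟨ m∸n+n≡m z≤M ⟩
      M         ∎
      where open ≤-Reasoning
    M∸y≡z∸a : M ∸ y ≡ z ∸ a
    M∸y≡z∸a = begin
      M ∸ (M ∸ z + a) ≡⟨ ∸-+-assoc M (M ∸ z) a ⟨
      M ∸ (M ∸ z) ∸ a ≡⟨ cong (_∸ a) (m∸[m∸n]≡n z≤M) ⟩
      z ∸ a           ∎
      where open ≡-Reasoning

  ∈S∧≤M⇒a∣ : ∀ z → z ≤ M → z ∈S S → a ∣ z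
  ∈S∧≤M⇒a∣ = <-rec _ step
    where
    step : ∀ z → (∀ {y} → y < z → y ≤ M → y ∈S S → a ∣ y) → z ≤ M → z ∈S S → a ∣ z
    step zero    _  _   _   = a ∣0
    step (suc z) ih z≤M z∈S = ∣m∸n∣n⇒∣m a a≤z
      (ih (∸-monoʳ-< 0<a a≤z) (≤-trans (m∸n≤m (suc z) a) z≤M) (∈S∧≤M⇒∸a∈S z≤M z∈S a≤z)) (n∣n)
      where
      a≤z : a ≤ suc z
      a≤z = a≤∈S z<s z∈S

  ∈S∧<g⇒a∣ : ∀ {z} → z < g → z ∈S S → a ∣ z
  ∈S∧<g⇒a∣ z<g z∈S = ∈S∧≤M⇒a∣ _ (∈S∧<g⇒≤M z<g z∈S) z∈S

  M+a∈S : (M + a) ∈S S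
  M+a∈S = closed S M a M∈S a∈S

  ∈S∧≥g⇒>g : ∀ {t} → g ≤ t → t ∈S S → g < t
  ∈S∧≥g⇒>g g≤t t∈S = ≤∧≢⇒< g≤t λ g≡t → ∉S⇒¬∈S g∉S (subst (_∈S S) (sym g≡t) t∈S)

  g<M+a : g < M + a
  g<M+a = ∈S∧≥g⇒>g (≮⇒≥ λ M+a<g → <⇒≱ (m<m+n M 0<a) (∈S∧<g⇒≤M M+a<g M+a∈S)) M+a∈S

  a∣∧window⇒≡M+a : ∀ {s} → a ∣ s → g < s → s < g + a → s ≡ M + a
  a∣∧window⇒≡M+a a∣s g<s s<g+a =
    ∣-between (∈S∧<g⇒a∣ M<g M∈S) a∣s (<-trans M<g g<s) (<-trans s<g+a (+-monoˡ-< a g<M+a))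

  module _ (a<g : a < g) where

    window⇒∈S : ∀ {s} → g < s → s < g + a → s ∈S S
    window⇒∈S {s} g<s s<g+a = subst (_∈S S) (m∸n+n≡m (<⇒≤ g<s))
      (∉S⇒+g∈S (<-trans s∸g<a a<g) (0<∧<a⇒∉S (m<n⇒0<n∸m g<s) s∸g<a))
      where
      s∸g<a : s ∸ g < a
      s∸g<a = subst (s ∸ g <_) (m+n∸m≡n g a) (∸-monoˡ-< s<g+a (<⇒≤ g<s))

    window-isMinGen : ∀ {s} → g < s → s < g + a → s ≢ M + a → isMinGen S s ≡ true
    window-isMinGen {s} g<s s<g+a s≢M+a =
      isMinGen-true S s (<-trans 1≤g g<s) (window⇒∈S g<s s<g+a) indecomposable
      where
      too-big : ∀ {u v} → g ≤ u → 0 < v → v ∈S S → u + v ≡ s → ⊥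
      too-big g≤u 0<v v∈S u+v≡s = <⇒≱ s<g+a (subst (g + a ≤_) u+v≡s (+-mono-≤ g≤u (a≤∈S 0<v v∈S)))
      indecomposable : IsIndecomposable S s
      indecomposable x y 0<x 0<y x+y≡s x∈S y∈S with x <? g | y <? g
      ... | yes x<g | yes y<g = s≢M+a (a∣∧window⇒≡M+a
            (subst (a ∣_) x+y≡s (∣m∣n⇒∣m+n (∈S∧<g⇒a∣ x<g x∈S) (∈S∧<g⇒a∣ y<g y∈S))) g<s s<g+a)
      ... | no x≮g  | _       = too-big (≮⇒≥ x≮g) 0<y y∈S x+y≡s
      ... | yes _   | no y≮g  = too-big (≮⇒≥ y≮g) 0<x x∈S (trans (+-comm y x) x+y≡s)

    a≤1+count-isMinGen-[g+a] : a ≤ suc (count (isMinGen S) (g + a))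
    a≤1+count-isMinGen-[g+a] = begin
      a                                         ≡⟨ suc-pred a ⟨
      1 + pred a                                ≤⟨ +-monoˡ-≤ (pred a) 1≤count-[1+g] ⟩
      count p (suc g) + pred a                  ≤⟨ +-monoʳ-≤ (count p (suc g)) (count-all-but-one w (pred a) j w-isMinGen) ⟩
      count p (suc g) + suc (count w (pred a))  ≡⟨ +-suc (count p (suc g)) _ ⟩
      suc (count p (suc g) + count w (pred a))  ≡⟨ cong suc (count-+ p (suc g) (pred a)) ⟨
      suc (count p (suc g + pred a))            ≡⟨ cong (λ n → suc (count p n)) 1+g+pred-a≡g+a ⟩
      suc (count p (g + a))                     ∎
      where
      open ≤-Reasoning
      instance
        a-nonZero : NonZero a
        a-nonZero = >-nonZero 0<a
      p : ℕ → Bool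
      p = isMinGen S
      w : ℕ → Bool
      w i = p (suc g + i)
      j : ℕ
      j = M + a ∸ suc g
      1+g+pred-a≡g+a : suc g + pred a ≡ g + a
      1+g+pred-a≡g+a = trans (sym (+-suc g (pred a))) (cong (g +_) (suc-pred a))
      1≤count-[1+g] : 1 ≤ count p (suc g)
      1≤count-[1+g] = begin
        1               ≤⟨ s≤s z≤n ⟩
        suc (count p a) ≡⟨ count-suc-true p a (<a+a⇒isMinGen 0<a a∈S (m<m+n a 0<a)) ⟨
        count p (suc a) ≤⟨ count-mono p (m≤n⇒m≤1+n a<g) ⟩
        count p (suc g) ∎
      w-isMinGen : ∀ i → i < pred a → i ≢ j → w i ≡ true
      w-isMinGen i i<pred-a i≢j = window-isMinGen (s≤s (m≤m+n g i))
        (subst (suc g + i <_) 1+g+pred-a≡g+a (+-monoʳ-< (suc g) i<pred-a))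
        λ 1+g+i≡M+a → i≢j (+-cancelˡ-≡ (suc g) i j (trans 1+g+i≡M+a (sym (m+[n∸m]≡n g<M+a))))

  F+a≡M+a+g : F + a ≡ M + a + g
  F+a≡M+a+g = begin
    F + a       ≡⟨ cong (_+ a) M+g≡F ⟨
    M + g + a   ≡⟨ +-assoc M g a ⟩
    M + (g + a) ≡⟨ cong (M +_) (+-comm g a) ⟩
    M + (a + g) ≡⟨ +-assoc M a g ⟨
    M + a + g   ∎
    where open ≡-Reasoning

  -- F + a ∸ x = (M + a ∸ x) + g, and M + a ∸ x is a multiple of a below g
  0<∧<g∧∈S⇒F+a∸∉S : ∀ {x} → 0 < x → x < g → x ∈S S → (F + a ∸ x) ∉S S
  0<∧<g∧∈S⇒F+a∸∉S {x} 0<x x<g x∈S = subst (_∉S S) z+g≡F+a∸x (∈S⇒+g∉S z<g z∈S)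
    where
    z : ℕ
    z = M + a ∸ x
    x≤M+a : x ≤ M + a
    x≤M+a = ≤-trans (∈S∧<g⇒≤M x<g x∈S) (m≤m+n M a)
    z<g : z < g
    z<g = begin-strict
      M + a ∸ x ≤⟨ ∸-monoʳ-≤ (M + a) (a≤∈S 0<x x∈S) ⟩
      M + a ∸ a ≡⟨ m+n∸n≡m M a ⟩
      M         <⟨ M<g ⟩
      g         ∎
      where open ≤-Reasoning
    z∈S : z ∈S S
    z∈S = a∣⇒∈S (∣m+n∣m⇒∣n
      (subst (a ∣_) (sym (m+[n∸m]≡n x≤M+a)) (∣m∣n⇒∣m+n (∈S∧<g⇒a∣ M<g M∈S) (n∣n)))
      (∈S∧<g⇒a∣ x<g x∈S))
    z+g≡F+a∸x : z + g ≡ F + a ∸ x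
    z+g≡F+a∸x = sym (trans (cong (_∸ x) F+a≡M+a+g) (+-∸-comm g x≤M+a))

  F+a-isMinGen : M + a ≤ suc g → isMinGen S (F + a) ≡ true
  F+a-isMinGen M+a≤1+g =
    isMinGen-true S (F + a) (<-≤-trans 0<a (m≤n+m a F)) (>F⇒∈S (m<m+n F 0<a)) indecomposable
    where
    open ≤-Reasoning
    one-below-g : ∀ {x y} → 0 < x → x < g → x + y ≡ F + a → x ∈S S → y ∈S S → ⊥
    one-below-g {x} {y} 0<x x<g x+y≡F+a x∈S y∈S = ∉S⇒¬∈S (0<∧<g∧∈S⇒F+a∸∉S 0<x x<g x∈S)
      (subst (_∈S S) (trans (sym (m+n∸m≡n x y)) (cong (_∸ x) x+y≡F+a)) y∈S)
    indecomposable : IsIndecomposable S (F + a)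
    indecomposable x y 0<x 0<y x+y≡F+a x∈S y∈S with x <? g | y <? g
    ... | yes x<g | no _    = one-below-g 0<x x<g x+y≡F+a x∈S y∈S
    ... | no _    | yes y<g = one-below-g 0<y y<g (trans (+-comm y x) x+y≡F+a) y∈S x∈S
    ... | yes x<g | yes y<g = <⇒≱ (begin-strict
      M + M     <⟨ +-monoʳ-< M M<g ⟩
      M + g     ≤⟨ m≤m+n (M + g) a ⟩
      M + g + a ≡⟨ cong (_+ a) M+g≡F ⟩
      F + a     ∎) (begin
      F + a     ≡⟨ x+y≡F+a ⟨
      x + y     ≤⟨ +-mono-≤ (∈S∧<g⇒≤M x<g x∈S) (∈S∧<g⇒≤M y<g y∈S) ⟩
      M + M     ∎)
    ... | no x≮g  | no y≮g  = <⇒≱ (begin-strict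
      F + a         ≡⟨ F+a≡M+a+g ⟩
      M + a + g     ≤⟨ +-monoˡ-≤ g M+a≤1+g ⟩
      suc g + g     <⟨ +-monoʳ-< (suc g) ≤-refl ⟩
      suc g + suc g ∎) (begin
      suc g + suc g ≤⟨ +-mono-≤ (∈S∧≥g⇒>g (≮⇒≥ x≮g) x∈S) (∈S∧≥g⇒>g (≮⇒≥ y≮g) y∈S) ⟩
      x + y         ≡⟨ x+y≡F+a ⟩
      F + a         ∎)

  e : ℕ
  e = embeddingDimension S F a

  F+1≡M+[1+g] : F + 1 ≡ M + suc g
  F+1≡M+[1+g] = begin
    F + 1       ≡⟨ +-comm F 1 ⟩
    suc F       ≡⟨ cong suc M+g≡F ⟨
    suc (M + g) ≡⟨ +-suc M g ⟨
    M + suc g   ∎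
    where open ≡-Reasoning

  c≤e⇒F+1≤e*[F+1∸g] : ∀ c → 2 ≤ c → c ≤ e → F + 1 ≤ M + M + c → F + 1 ≤ e * ((F + 1) ∸ g)
  c≤e⇒F+1≤e*[F+1∸g] c 2≤c c≤e F+1≤M+M+c = begin
    F + 1           ≤⟨ F+1≤M+M+c ⟩
    M + M + c       ≤⟨ m+m+c≤c*[1+m] 2≤c ⟩
    c * suc M       ≤⟨ *-monoˡ-≤ (suc M) c≤e ⟩
    e * suc M       ≡⟨ cong (e *_) F+1∸g≡1+M ⟨
    e * ((F + 1) ∸ g) ∎
    where
    open ≤-Reasoning
    F+1∸g≡1+M : (F + 1) ∸ g ≡ suc M
    F+1∸g≡1+M = trans (cong (_∸ g) (trans F+1≡M+[1+g] (+-suc M g))) (m+n∸n≡m (suc M) g)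

  a≤e⇒F+1≤e*[F+1∸g] : a ≤ e → F + 1 ≤ e * ((F + 1) ∸ g)
  a≤e⇒F+1≤e*[F+1∸g] a≤e = c≤e⇒F+1≤e*[F+1∸g] a 2≤a a≤e (begin
    F + 1       ≡⟨ F+1≡M+[1+g] ⟩
    M + suc g   ≤⟨ +-monoʳ-≤ M g<M+a ⟩
    M + (M + a) ≡⟨ +-assoc M M a ⟨
    M + M + a   ∎)
    where
    open ≤-Reasoning
    2≤a : 2 ≤ a
    2≤a = ≤∧≢⇒< 0<a λ 1≡a → ∉S⇒¬∈S g∉S (a∣⇒∈S (subst (_∣ g) 1≡a (1∣ g)))

  g<a⇒a≤e : g < a → a ≤ e
  g<a⇒a≤e g<a = begin
    a                          ≤⟨ F<a⇒a≤count-isMinGen isF F<a ⟩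
    count (isMinGen S) (a + a) ≤⟨ count-mono (isMinGen S) (+-monoˡ-≤ a (a≤∈S z<s (>F⇒∈S ≤-refl))) ⟩
    e                          ∎
    where
    open ≤-Reasoning
    M≡0 : M ≡ 0
    M≡0 = n≤0⇒n≡0 (≮⇒≥ λ 0<M → <⇒≱ (<-trans M<g g<a) (a≤∈S 0<M M∈S))
    F<a : F < a
    F<a = subst (_< a) (trans (cong (_+ g) (sym M≡0)) M+g≡F) g<a

  a<g∧M+a≤1+g⇒a≤e : a < g → M + a ≤ suc g → a ≤ e
  a<g∧M+a≤1+g⇒a≤e a<g M+a≤1+g = begin
    a                                  ≤⟨ a≤1+count-isMinGen-[g+a] a<g ⟩
    suc (count (isMinGen S) (g + a))   ≤⟨ s≤s (count-mono (isMinGen S) (+-monoˡ-≤ a g≤F)) ⟩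
    suc (count (isMinGen S) (F + a))   ≡⟨ count-suc-true (isMinGen S) (F + a) (F+a-isMinGen M+a≤1+g) ⟨
    e                                  ∎
    where open ≤-Reasoning

  a<g∧1+g<M+a⇒F+1≤e*[F+1∸g] : a < g → suc g < M + a → F + 1 ≤ e * ((F + 1) ∸ g)
  a<g∧1+g<M+a⇒F+1≤e*[F+1∸g] a<g 1+g<M+a = c≤e⇒F+1≤e*[F+1∸g] c 2≤c c≤e (begin
    F + 1       ≡⟨ F+1≡M+[1+g] ⟩
    M + suc g   ≤⟨ +-monoʳ-≤ M 1+g≤M+c ⟩
    M + (M + c) ≡⟨ +-assoc M M c ⟨
    M + M + c   ∎)
    where
    open ≤-Reasoning
    c : ℕ
    c = count (isMinGen S) (g + a)
    c≤e : c ≤ e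
    c≤e = count-mono (isMinGen S) (m≤n⇒m≤1+n (+-monoˡ-≤ a g≤F))
    1+g≤M+c : suc g ≤ M + c
    1+g≤M+c = s≤s⁻¹ (begin
      2+ g        ≤⟨ 1+g<M+a ⟩
      M + a       ≤⟨ +-monoʳ-≤ M (a≤1+count-isMinGen-[g+a] a<g) ⟩
      M + suc c   ≡⟨ +-suc M c ⟩
      suc (M + c) ∎)
    2≤c : 2 ≤ c
    2≤c = +-cancelʳ-≤ g 2 c (begin
      2+ g        ≤⟨ s≤s 1+g≤M+c ⟩
      suc (M + c) ≤⟨ +-monoˡ-< c M<g ⟩
      g + c       ≡⟨ +-comm g c ⟩
      c + g       ∎)

corollary4p20 : (S : NumericalSemigroup) (F g a : ℕ) →
    IsFrobenius S F → genus S F ≡ g → 1 ≤ g → IsMultiplicity S a →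
    IsReflective S g →
    F + 1 ≤ embeddingDimension S F a * ((F + 1) ∸ g)
corollary4p20 S F g a isF genus≡g 1≤g isM reflective = by-cases (<-cmp a g)
  where
  open Reflective S F g a isF genus≡g 1≤g isM reflective
  by-cases : Tri (a < g) (a ≡ g) (g < a) → F + 1 ≤ e * ((F + 1) ∸ g)
  by-cases (tri> _ _ g<a) = a≤e⇒F+1≤e*[F+1∸g] (g<a⇒a≤e g<a)
  by-cases (tri≈ _ a≡g _) = ⊥-elim (∉S⇒¬∈S g∉S (subst (_∈S S) a≡g a∈S))
  by-cases (tri< a<g _ _) with M + a ≤? suc g
  ... | yes M+a≤1+g = a≤e⇒F+1≤e*[F+1∸g] (a<g∧M+a≤1+g⇒a≤e a<g M+a≤1+g)
  ... | no  M+a≰1+g = a<g∧1+g<M+a⇒F+1≤e*[F+1∸g] a<g (≰⇒> M+a≰1+g)
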